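{- Let $q=p^r$ with $p$ prime and $r$ a positive integer. A point of $\mathbb{P}^3(\mathbb{F}_{q^2})$ lies on the surface $u^{q-1}+v^{q-1}+w^{q-1}+x^{q-1}=0$ if and only if it is of one of the following forms: (1) $(u_1:u_2:u_3:u_4)$ with $u_i\in\mathbb{F}_{q^2}$, not all zero, such that there is a permutation $\sigma$ of $\{1,2,3,4\}$ with $u_{\sigma(1)}^{q-1}=-u_{\sigma(2)}^{q-1}$ and $u_{\sigma(3)}^{q-1}=-u_{\sigma(4)}^{q-1}$; (2) when $q\equiv 2\pmod 3$: $(u_1:u_2:u_3:u_4)$ with $u_i\in\mathbb{F}_{q^2}$ in which exactly one $u_i$ is zero and the $(q-1)$-th powers of the other three $u_i$ are distinct cube roots of unity; (3) when $q\equiv 0\pmod 3$: $(u_1:u_2:u_3:u_4)$ with $u_i\in\mathbb{F}_q$ and exactly one $u_i$ equal to zero.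
   Context: $\mathbb{F}_{q^2}$ is the finite field with $q^2$ elements and $\mathbb{P}^3(\mathbb{F}_{q^2})$ the projective 3-space over it. -}

module Defs where

open import Level using (Level; _⊔_)
open import Data.Nat using (ℕ; _∸_)
import Data.Nat as ℕ
open import Data.Nat.Primality using (Prime)
open import Data.Fin using (Fin)
import Data.Fin as F
open import Data.Fin.Permutation using (Permutation′; _⟨$⟩ʳ_)
open import Data.Product using (Σ; ∃; ∃-syntax; _×_; _,_)
open import Data.Sum using (_⊎_)
open import Relation.Nullary using (¬_)
open import Relation.Binary.PropositionalEquality using (_≡_)
import Relation.Binary.PropositionalEquality as ≡
open import Function.Bundles using (Inverse)
open import Algebra.Bundles using (CommutativeRing)

record IsField {c ℓ : Level} (F : CommutativeRing c ℓ) : Set (c ⊔ ℓ) where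
  open CommutativeRing F
  field
    0≉1     : ¬ (0# ≈ 1#)
    inverse : ∀ x → ¬ (x ≈ 0#) → ∃[ y ] (x * y ≈ 1#)

HasCardinality : {c ℓ : Level} → CommutativeRing c ℓ → ℕ → Set (c ⊔ ℓ)
HasCardinality F n = Inverse (CommutativeRing.setoid F) (≡.setoid (Fin n))

module FieldNotions {c ℓ : Level} (F : CommutativeRing c ℓ) where
  open CommutativeRing F using (Carrier; _≈_; _+_; _*_; -_; 0#; 1#)

  infixr 8 _^ᶠ_
  _^ᶠ_ : Carrier → ℕ → Carrier
  x ^ᶠ ℕ.zero  = 1#
  x ^ᶠ ℕ.suc n = x * (x ^ᶠ n)

  Coords : Set c
  Coords = Fin 4 → Carrier

  NonZeroTuple : Coords → Set ℓ
  NonZeroTuple u = ¬ (∀ i → u i ≈ 0#)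

  scale : Carrier → Coords → Coords
  scale λ' u i = λ' * u i

  OnSurface : ℕ → Coords → Set ℓ
  OnSurface q u =
    (u F.zero ^ᶠ (q ∸ 1)) + (u (F.suc F.zero) ^ᶠ (q ∸ 1))
      + (u (F.suc (F.suc F.zero)) ^ᶠ (q ∸ 1)) + (u (F.suc (F.suc (F.suc F.zero))) ^ᶠ (q ∸ 1))
      ≈ 0#

  Form1 : ℕ → Coords → Set ℓ
  Form1 q u = NonZeroTuple u × ∃ λ (σ : Permutation′ 4) →
    ((u (σ ⟨$⟩ʳ F.zero) ^ᶠ (q ∸ 1)) ≈ - (u (σ ⟨$⟩ʳ F.suc F.zero) ^ᶠ (q ∸ 1))
    × (u (σ ⟨$⟩ʳ F.suc (F.suc F.zero)) ^ᶠ (q ∸ 1))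
        ≈ - (u (σ ⟨$⟩ʳ F.suc (F.suc (F.suc F.zero))) ^ᶠ (q ∸ 1)))

  ExactlyOneZeroAt : Coords → Fin 4 → Set ℓ
  ExactlyOneZeroAt u i = (u i ≈ 0#) × (∀ j → ¬ (j ≡ i) → ¬ (u j ≈ 0#))

  CubeRootOfUnity : Carrier → Set ℓ
  CubeRootOfUnity z = z ^ᶠ 3 ≈ 1#

  Form2 : ℕ → Coords → Set ℓ
  Form2 q u = ∃[ i ] ∃[ j ] ∃[ k ] ∃[ l ]
    (ExactlyOneZeroAt u i
    × ¬ (i ≡ j) × ¬ (i ≡ k) × ¬ (i ≡ l) × ¬ (j ≡ k) × ¬ (j ≡ l) × ¬ (k ≡ l)
    × CubeRootOfUnity (u j ^ᶠ (q ∸ 1))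
    × CubeRootOfUnity (u k ^ᶠ (q ∸ 1))
    × CubeRootOfUnity (u l ^ᶠ (q ∸ 1))
    × ¬ ((u j ^ᶠ (q ∸ 1)) ≈ (u k ^ᶠ (q ∸ 1)))
    × ¬ ((u j ^ᶠ (q ∸ 1)) ≈ (u l ^ᶠ (q ∸ 1)))
    × ¬ ((u k ^ᶠ (q ∸ 1)) ≈ (u l ^ᶠ (q ∸ 1))))

  -- membership in the subfield F_q ⊆ F_{q²}: the fixed points of x ↦ x^q
  InSubfield : ℕ → Carrier → Set ℓ
  InSubfield q x = x ^ᶠ q ≈ x

  Form3 : ℕ → Coords → Set ℓ
  Form3 q u = (∀ i → InSubfield q (u i)) × ∃[ i ] ExactlyOneZeroAt u i

  -- A projective point (represented by the nonzero tuple u) "is of form P"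
  -- if some representative λ·u (λ ≠ 0) satisfies P.
  PointOfForm : (Coords → Set ℓ) → Coords → Set (c ⊔ ℓ)
  PointOfForm P u = ∃[ λ' ] (¬ (λ' ≈ 0#) × P (scale λ' u))

{-# OPTIONS --safe #-}
module Submission where

-- Write ν x = x ^ (q - 1). As |F| = q², x ^ (q²) = x, so (ν x) ^ q = (ν x)⁻¹ for x ≠ 0, and
-- x ↦ x ^ q is additive since p divides the inner binomial coefficients. The values aᵢ = ν uᵢ of
-- a point on the surface therefore satisfy Σ aᵢ = 0 and, over the nonzero ones, Σ aᵢ⁻¹ = 0.
-- With no zero coordinate, (a₁ + a₂)(a₁ + a₃)(a₁ + a₄) = a₁² Σ aᵢ + a₁a₂a₃a₄ Σ aᵢ⁻¹ = 0 yields a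
-- pairing (form 1); two zero coordinates pair with each other and force the other two to pair.
-- With exactly one zero, scale the point so that the other values are 1, y, z: then
-- 1 + y + z = 0 = 1 + y⁻¹ + z⁻¹ gives yz = 1 and y² + y + 1 = 0, hence y³ = 1, which together
-- with y ^ (q + 1) = 1 forces y = 1 unless q ≡ 2 (mod 3). For q ≡ 2 the values 1, y, z are the
-- three cube roots of unity (form 2); otherwise y = z = 1, so 3 = 0 in F, q ≡ 0 (mod 3) and the
-- scaled coordinates lie in F_q (form 3). Conversely, three distinct cube roots of unity sum to 0.

open import Defs
open import Level using (Level)
open import Data.Nat using (ℕ; _^_; _%_; _≥_)
open import Data.Nat.Primality using (Prime)
open import Data.Product using (_×_)
open import Data.Sum using (_⊎_)
open import Relation.Binary.PropositionalEquality using (_≡_)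
open import Function.Bundles using (_⇔_)
open import Algebra.Bundles using (CommutativeRing)

open import Level using (_⊔_)
open import Data.Nat using (zero; suc; _∸_; _/_; _<_; z≤n; s≤s)
import Data.Nat as ℕ
import Data.Nat.Properties as ℕ
open import Data.Nat.DivMod using (m≡m%n+[m/n]*n; m%n<n)
open import Data.Nat.Divisibility using (divides)
open import Data.Nat.Combinatorics using (_C_; nCn≡1)
open import Data.Nat.Primality using (prime⇒nonZero)
open import Data.Fin using (Fin; zero; suc; toℕ; fromℕ; inject₁; punchIn; punchOut)
open import Data.Fin.Patterns using (0F; 1F; 2F; 3F)
import Data.Fin.Properties as Fin
open import Data.Fin.Properties
  using (any?; 0≢1+n; suc-injective; inject₁ℕ<; toℕ-fromℕ; punchInᵢ≢i; punchIn-injective; punchOut-injective; punchIn-punchOut)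
open import Data.Fin.Permutation using (Permutation′; _⟨$⟩ʳ_; insert; id)
open import Data.Vec.Functional using ([]; _∷_; removeAt)
open import Data.Product using (_,_; ∃-syntax; proj₁; proj₂)
open import Data.Sum using (inj₁; inj₂; [_,_]′)
open import Data.Empty using (⊥)
open import Function.Base using (_∘_)
open import Function.Bundles using (Inverse; mk⇔; Equivalence)
open import Function.Definitions using (Injective; Congruent)
open import Relation.Nullary using (¬_; Dec; yes; no; contradiction)
open import Relation.Binary.Definitions using (Decidable)
open import Relation.Binary.PropositionalEquality as ≡ using (_≢_)
open import Algebra.Bundles using (CommutativeMonoid)

module Arithmetic where
  open import Data.Nat
  open import Data.Nat.Properties
  open import Data.Nat.Divisibility
  open import Data.Nat.Primality
  open import Data.Nat.Combinatorics
  open import Data.Nat.DivMod using (m/n*n≡m)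
  open import Relation.Nullary.Decidable using (from-yes)
  open import Relation.Binary.PropositionalEquality

  prime⇒≥2 : ∀ {p} → Prime p → 2 ≤ p
  prime⇒≥2 {p} pp = nonTrivial⇒n>1 p {{prime⇒nonTrivial pp}}

  prime[3] : Prime 3
  prime[3] = from-yes (prime? 3)

  prime∣m!⇒≤ : ∀ {p} m → Prime p → p ∣ m ! → p ≤ m
  prime∣m!⇒≤ zero    pp p∣1 = contradiction (∣⇒≤ p∣1) (<⇒≱ (prime⇒≥2 pp))
  prime∣m!⇒≤ (suc m) pp p∣m! with euclidsLemma (suc m) (m !) pp p∣m!
  ... | inj₁ p∣1+m = ∣⇒≤ p∣1+m
  ... | inj₂ p∣m!′ = m≤n⇒m≤1+n (prime∣m!⇒≤ m pp p∣m!′)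

  n∣n! : ∀ {n} → .{{NonZero n}} → n ∣ n !
  n∣n! {suc n} = m∣m*n (n !)

  choose*factorials≡! : ∀ {n k} → k ≤ n → (n C k) * (k ! * (n ∸ k) !) ≡ n !
  choose*factorials≡! {n} {k} k≤n = trans (cong (_* (k ! * (n ∸ k) !)) (nCk≡n!/k![n-k]! k≤n)) (m/n*n≡m (k![n∸k]!∣n! k≤n))
    where instance _ = k !* (n ∸ k) !≢0

  prime∣prime-choose : ∀ {p k} → Prime p → 0 < k → k < p → p ∣ p C k
  prime∣prime-choose {p} {k} pp 0<k k<p
    with euclidsLemma (p C k) (k ! * (p ∸ k) !) pp
           (subst (p ∣_) (sym (choose*factorials≡! (<⇒≤ k<p))) (n∣n! {p} {{prime⇒nonZero pp}}))
  ... | inj₁ p∣pCk = p∣pCk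
  ... | inj₂ p∣k![p∸k]! with euclidsLemma (k !) ((p ∸ k) !) pp p∣k![p∸k]!
  ...   | inj₁ p∣k!      = contradiction (prime∣m!⇒≤ k pp p∣k!) (<⇒≱ k<p)
  ...   | inj₂ p∣[p∸k]! =
    contradiction (prime∣m!⇒≤ (p ∸ k) pp p∣[p∸k]!) (<⇒≱ (∸-monoʳ-< 0<k (<⇒≤ k<p)))

  prime∣prime^⇒≡ : ∀ {d p} r → Prime d → Prime p → d ∣ p ^ r → d ≡ p
  prime∣prime^⇒≡ zero    pd _  d∣1 = contradiction (∣⇒≤ d∣1) (<⇒≱ (prime⇒≥2 pd))
  prime∣prime^⇒≡ {d} {p} (suc r) pd pp d∣p^[1+r] with euclidsLemma p (p ^ r) pd d∣p^[1+r]
  ... | inj₂ d∣p^r = prime∣prime^⇒≡ r pd pp d∣p^r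
  ... | inj₁ d∣p with prime⇒irreducible pp d∣p
  ...   | inj₁ d≡1 = contradiction (subst (2 ≤_) d≡1 (prime⇒≥2 pd)) λ { (s≤s ()) }
  ...   | inj₂ d≡p = d≡p

  prime^%3≡0⇔≡3 : ∀ {p} r → Prime p → r ≥ 1 → p ^ r % 3 ≡ 0 ⇔ p ≡ 3
  prime^%3≡0⇔≡3 {p} r pp r≥1 = mk⇔
    (λ p^r%3≡0 → sym (prime∣prime^⇒≡ r prime[3] pp (m%n≡0⇒n∣m (p ^ r) 3 p^r%3≡0)))
    (λ { refl → n∣m⇒m%n≡0 (3 ^ r) 3 (3∣3^r r≥1) })
    where
    3∣3^r : ∀ {r} → r ≥ 1 → 3 ∣ 3 ^ r
    3∣3^r {suc r} _ = m∣m*n (3 ^ r)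

  prime≢3⇒%3≢0 : ∀ {p} → Prime p → p ≢ 3 → p % 3 ≢ 0
  prime≢3⇒%3≢0 {p} pp p≢3 p%3≡0 with prime⇒irreducible pp (m%n≡0⇒n∣m p 3 p%3≡0)
  ... | inj₁ ()
  ... | inj₂ 3≡p = p≢3 (sym 3≡p)

  1+[n∸1]+[n∸1]n≡n² : ∀ n → n ≥ 1 → suc ((n ∸ 1) + (n ∸ 1) * n) ≡ n ^ 2
  1+[n∸1]+[n∸1]n≡n² (suc m) _ = cong (suc m *_) (sym (*-identityʳ (suc m)))

  n≡1+[n∸1] : ∀ {n} → n ≥ 1 → n ≡ suc (n ∸ 1)
  n≡1+[n∸1] (s≤s _) = refl

  n∸1≡1+[n∸2] : ∀ {n} → n ≥ 2 → n ∸ 1 ≡ suc (n ∸ 2)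
  n∸1≡1+[n∸2] (s≤s (s≤s _)) = refl

module SumReindexing {c ℓ} (M : CommutativeMonoid c ℓ) where
  open CommutativeMonoid M
  open import Algebra.Properties.CommutativeMonoid.Sum M using (sum; sum-remove; sum-cong-≗; sum-cong-≋; sum-replicate-zero)
  open import Relation.Binary.Reasoning.Setoid setoid

  sum-reindex : ∀ {n} (t : Fin n → Carrier) {ι : Fin n → Fin n} →
                Injective _≡_ _≡_ ι → sum (t ∘ ι) ≈ sum t
  sum-reindex {zero}  t         _     = refl
  sum-reindex {suc n} t {ι} ι-inj = begin
    t (ι zero) ∙ sum (t ∘ ι ∘ suc)           ≡⟨ ≡.cong (t (ι zero) ∙_) (sum-cong-≗ t∘ι∘suc≗) ⟩
    t (ι zero) ∙ sum (removeAt t (ι zero) ∘ ι′) ≈⟨ ∙-congˡ (sum-reindex (removeAt t (ι zero)) ι′-inj) ⟩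
    t (ι zero) ∙ sum (removeAt t (ι zero))   ≈⟨ sum-remove t ⟨
    sum t                                   ∎
    where
    ι₀≢ι₁₊ : ∀ k → ι zero ≢ ι (suc k)
    ι₀≢ι₁₊ k = 0≢1+n ∘ ι-inj
    ι′ : Fin n → Fin n
    ι′ k = punchOut (ι₀≢ι₁₊ k)
    ι′-inj : Injective _≡_ _≡_ ι′
    ι′-inj = suc-injective ∘ ι-inj ∘ punchOut-injective (ι₀≢ι₁₊ _) (ι₀≢ι₁₊ _)
    t∘ι∘suc≗ : ∀ k → t (ι (suc k)) ≡ removeAt t (ι zero) (ι′ k)
    t∘ι∘suc≗ k = ≡.cong t (≡.sym (punchIn-punchOut (ι₀≢ι₁₊ k)))

  sum-single : ∀ {n} (t : Fin n → Carrier) i → (∀ j → j ≢ i → t j ≈ ε) → sum t ≈ t i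
  sum-single {suc n} t i t≈ε = begin
    sum t                        ≈⟨ sum-remove t ⟩
    t i ∙ sum (removeAt t i)     ≈⟨ ∙-congˡ (trans (sum-cong-≋ (λ k → t≈ε _ (punchInᵢ≢i i k))) (sum-replicate-zero n)) ⟩
    t i ∙ ε                      ≈⟨ identityʳ (t i) ⟩
    t i                          ∎

  module _ {N} (enumeration : Inverse setoid (≡.setoid (Fin N))) where
    open Inverse enumeration

    sum-elements-reindex : ∀ {φ g : Carrier → Carrier} → Congruent _≈_ _≈_ g →
      (∀ {x y} → φ x ≈ φ y → x ≈ y) → sum (g ∘ φ ∘ from) ≈ sum (g ∘ from)
    sum-elements-reindex {φ} {g} g-cong φ-inj = begin
      sum (g ∘ φ ∘ from)      ≈⟨ sum-cong-≋ (λ i → g-cong (strictlyInverseʳ (φ (from i)))) ⟨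
      sum (g ∘ from ∘ ι)      ≈⟨ sum-reindex (g ∘ from) ι-inj ⟩
      sum (g ∘ from)          ∎
      where
      ι : Fin N → Fin N
      ι = to ∘ φ ∘ from
      ι-inj : Injective _≡_ _≡_ ι
      ι-inj {i} {j} ιi≡ιj =
        ≡.trans (≡.sym (strictlyInverseˡ i)) (≡.trans (to-cong (φ-inj φfi≈φfj)) (strictlyInverseˡ j))
        where
        φfi≈φfj : φ (from i) ≈ φ (from j)
        φfi≈φfj = begin
          φ (from i)     ≈⟨ strictlyInverseʳ (φ (from i)) ⟨
          from (ι i)     ≡⟨ ≡.cong from ιi≡ιj ⟩
          from (ι j)     ≈⟨ strictlyInverseʳ (φ (from j)) ⟩
          φ (from j)     ∎

module RingFacts {c ℓ} (R : CommutativeRing c ℓ) where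
  open CommutativeRing R hiding (zero)
  open FieldNotions R using (_^ᶠ_)
  open import Relation.Binary.Reasoning.Setoid setoid
  open import Algebra.Properties.Semiring.Exp semiring using (^-congˡ; ^-homo-*; ^-assocʳ) renaming (_^_ to _^ˢ_)
  open import Algebra.Properties.CommutativeSemiring.Exp commutativeSemiring using (^-distrib-*)
  open import Algebra.Properties.Semiring.Mult semiring using (×-congʳ; ×-assoc-*; ×-homo-+; ×1-homo-*) renaming (_×_ to _×ₙ_)
  import Algebra.Properties.CommutativeSemiring.Binomial commutativeSemiring as Binomial
  open import Algebra.Properties.Semiring.Sum semiring using (sum; sum-init-last; sum-cong-≋; sum-replicate-zero)

  ^ᶠ≈^ : ∀ x n → x ^ᶠ n ≈ x ^ˢ n
  ^ᶠ≈^ x zero    = refl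
  ^ᶠ≈^ x (suc n) = *-congˡ (^ᶠ≈^ x n)

  ^ᶠ-congˡ : ∀ n {x y} → x ≈ y → x ^ᶠ n ≈ y ^ᶠ n
  ^ᶠ-congˡ n {x} {y} x≈y = begin
    x ^ᶠ n   ≈⟨ ^ᶠ≈^ x n ⟩
    x ^ˢ n   ≈⟨ ^-congˡ n x≈y ⟩
    y ^ˢ n   ≈⟨ ^ᶠ≈^ y n ⟨
    y ^ᶠ n   ∎

  ^ᶠ-homo-* : ∀ x m n → x ^ᶠ (m ℕ.+ n) ≈ x ^ᶠ m * x ^ᶠ n
  ^ᶠ-homo-* x m n = begin
    x ^ᶠ (m ℕ.+ n)      ≈⟨ ^ᶠ≈^ x (m ℕ.+ n) ⟩
    x ^ˢ (m ℕ.+ n)      ≈⟨ ^-homo-* x m n ⟩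
    x ^ˢ m * x ^ˢ n     ≈⟨ *-cong (^ᶠ≈^ x m) (^ᶠ≈^ x n) ⟨
    x ^ᶠ m * x ^ᶠ n     ∎

  ^ᶠ-assocʳ : ∀ x m n → (x ^ᶠ m) ^ᶠ n ≈ x ^ᶠ (m ℕ.* n)
  ^ᶠ-assocʳ x m n = begin
    (x ^ᶠ m) ^ᶠ n       ≈⟨ ^ᶠ≈^ (x ^ᶠ m) n ⟩
    (x ^ᶠ m) ^ˢ n       ≈⟨ ^-congˡ n (^ᶠ≈^ x m) ⟩
    (x ^ˢ m) ^ˢ n       ≈⟨ ^-assocʳ x m n ⟩
    x ^ˢ (m ℕ.* n)      ≈⟨ ^ᶠ≈^ x (m ℕ.* n) ⟨
    x ^ᶠ (m ℕ.* n)      ∎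

  ^ᶠ-distrib-* : ∀ x y n → (x * y) ^ᶠ n ≈ x ^ᶠ n * y ^ᶠ n
  ^ᶠ-distrib-* x y n = begin
    (x * y) ^ᶠ n        ≈⟨ ^ᶠ≈^ (x * y) n ⟩
    (x * y) ^ˢ n        ≈⟨ ^-distrib-* x y n ⟩
    x ^ˢ n * y ^ˢ n     ≈⟨ *-cong (^ᶠ≈^ x n) (^ᶠ≈^ y n) ⟨
    x ^ᶠ n * y ^ᶠ n     ∎

  1^ᶠ : ∀ n → 1# ^ᶠ n ≈ 1#
  1^ᶠ zero    = refl
  1^ᶠ (suc n) = trans (*-identityˡ _) (1^ᶠ n)

  ×1-homo-^ : ∀ m k → (m ^ k) ×ₙ 1# ≈ (m ×ₙ 1#) ^ᶠ k
  ×1-homo-^ m zero    = +-identityʳ 1#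
  ×1-homo-^ m (suc k) = trans (×1-homo-* m (m ^ k)) (*-congˡ (×1-homo-^ m k))

  ×1≈0⇒×≈0 : ∀ {n} → n ×ₙ 1# ≈ 0# → ∀ x → n ×ₙ x ≈ 0#
  ×1≈0⇒×≈0 {n} n≈0 x = begin
    n ×ₙ x          ≈⟨ ×-congʳ n (*-identityˡ x) ⟨
    n ×ₙ (1# * x)   ≈⟨ ×-assoc-* n 1# x ⟨
    (n ×ₙ 1#) * x   ≈⟨ *-congʳ n≈0 ⟩
    0# * x          ≈⟨ zeroˡ x ⟩
    0#              ∎

  ×1≈0⇒multiple×1≈0 : ∀ {n} → n ×ₙ 1# ≈ 0# → ∀ d → (d ℕ.* n) ×ₙ 1# ≈ 0#
  ×1≈0⇒multiple×1≈0 {n} n≈0 d = begin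
    (d ℕ.* n) ×ₙ 1#           ≈⟨ ×1-homo-* d n ⟩
    (d ×ₙ 1#) * (n ×ₙ 1#)     ≈⟨ *-congˡ n≈0 ⟩
    (d ×ₙ 1#) * 0#            ≈⟨ zeroʳ _ ⟩
    0#                        ∎

  sum-ends : ∀ {n} (t : Fin (suc n) → Carrier) → 0 < n →
             (∀ i → 0 < toℕ i → toℕ i < n → t i ≈ 0#) → sum t ≈ t zero + t (fromℕ n)
  sum-ends {suc m} t _ inner≈0 = begin
    t zero + sum (t ∘ suc)                                   ≈⟨ +-congˡ (sum-init-last (t ∘ suc)) ⟩
    t zero + (sum (t ∘ suc ∘ inject₁) + t (fromℕ (suc m)))  ≈⟨ +-congˡ (+-congʳ inner-sum≈0) ⟩
    t zero + (0# + t (fromℕ (suc m)))                        ≈⟨ +-congˡ (+-identityˡ _) ⟩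
    t zero + t (fromℕ (suc m))                               ∎
    where
    inner-sum≈0 : sum (t ∘ suc ∘ inject₁) ≈ 0#
    inner-sum≈0 = trans (sum-cong-≋ λ j → inner≈0 (suc (inject₁ j)) (s≤s z≤n) (s≤s (inject₁ℕ< j))) (sum-replicate-zero m)

  ×1-mod : ∀ {n} .{{_ : ℕ.NonZero n}} → n ×ₙ 1# ≈ 0# → ∀ m → m ×ₙ 1# ≈ (m % n) ×ₙ 1#
  ×1-mod {n} n≈0 m = begin
    m ×ₙ 1#                                     ≡⟨ ≡.cong (_×ₙ 1#) (m≡m%n+[m/n]*n m n) ⟩
    (m % n ℕ.+ (m / n) ℕ.* n) ×ₙ 1#             ≈⟨ ×-homo-+ 1# (m % n) ((m / n) ℕ.* n) ⟩
    (m % n) ×ₙ 1# + ((m / n) ℕ.* n) ×ₙ 1#       ≈⟨ +-congˡ (×1≈0⇒multiple×1≈0 n≈0 (m / n)) ⟩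
    (m % n) ×ₙ 1# + 0#                          ≈⟨ +-identityʳ _ ⟩
    (m % n) ×ₙ 1#                               ∎

  cube-root≈1 : ∀ {y} n → y ^ᶠ 3 ≈ 1# → y ^ᶠ suc n ≈ 1# → n % 3 ≢ 2 → y ≈ 1#
  cube-root≈1 {y} n y³≈1 y¹⁺ⁿ≈1 n%3≢2 = by-residue (n % 3) (m%n<n n 3) n%3≢2 y¹⁺ⁿ%³≈1
    where
    y¹⁺ⁿ%³≈1 : y ^ᶠ suc (n % 3) ≈ 1#
    y¹⁺ⁿ%³≈1 = begin
      y ^ᶠ suc (n % 3)                             ≈⟨ *-identityʳ _ ⟨
      y ^ᶠ suc (n % 3) * 1#                        ≈⟨ *-congˡ (trans (^ᶠ-congˡ (n / 3) y³≈1) (1^ᶠ (n / 3))) ⟨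
      y ^ᶠ suc (n % 3) * (y ^ᶠ 3) ^ᶠ (n / 3)      ≈⟨ *-congˡ (^ᶠ-assocʳ y 3 (n / 3)) ⟩
      y ^ᶠ suc (n % 3) * y ^ᶠ (3 ℕ.* (n / 3))     ≈⟨ ^ᶠ-homo-* y (suc (n % 3)) (3 ℕ.* (n / 3)) ⟨
      y ^ᶠ (suc (n % 3) ℕ.+ 3 ℕ.* (n / 3))         ≡⟨ ≡.cong (λ k → y ^ᶠ suc k) n%3+3[n/3]≡n ⟩
      y ^ᶠ suc n                                   ≈⟨ y¹⁺ⁿ≈1 ⟩
      1#                                           ∎
      where
      n%3+3[n/3]≡n : n % 3 ℕ.+ 3 ℕ.* (n / 3) ≡ n
      n%3+3[n/3]≡n = ≡.trans (≡.cong (n % 3 ℕ.+_) (ℕ.*-comm 3 (n / 3))) (≡.sym (m≡m%n+[m/n]*n n 3))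
    by-residue : ∀ s → s < 3 → s ≢ 2 → y ^ᶠ suc s ≈ 1# → y ≈ 1#
    by-residue 0 _ _ y¹≈1 = trans (sym (*-identityʳ y)) y¹≈1
    by-residue 1 _ _ y²≈1 = begin
      y             ≈⟨ *-identityʳ y ⟨
      y * 1#        ≈⟨ *-congˡ y²≈1 ⟨
      y ^ᶠ 3        ≈⟨ y³≈1 ⟩
      1#            ∎
    by-residue 2 _ 2≢2 _ = contradiction ≡.refl 2≢2
    by-residue (suc (suc (suc _))) (s≤s (s≤s (s≤s ())))

  module Frobenius {p} (p-prime : Prime p) (char-p : p ×ₙ 1# ≈ 0#) where
    open Arithmetic using (prime⇒≥2; prime∣prime-choose)

    binomial×1≈0 : ∀ {k} → 0 < k → k < p → (p C k) ×ₙ 1# ≈ 0#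
    binomial×1≈0 0<k k<p with prime∣prime-choose p-prime 0<k k<p
    ... | divides d pCk≡d*p = ≡.subst (λ n → n ×ₙ 1# ≈ 0#) (≡.sym pCk≡d*p) (×1≈0⇒multiple×1≈0 char-p d)

    frobenius : ∀ x y → (x + y) ^ᶠ p ≈ x ^ᶠ p + y ^ᶠ p
    frobenius x y = begin
      (x + y) ^ᶠ p                     ≈⟨ ^ᶠ≈^ (x + y) p ⟩
      (x + y) ^ˢ p                     ≈⟨ Binomial.theorem p x y ⟩
      sum {suc p} (term ∘ toℕ)         ≈⟨ sum-ends (term ∘ toℕ) (ℕ.<⇒≤ (prime⇒≥2 p-prime)) middle≈0 ⟩
      term 0 + term (toℕ (fromℕ p))    ≡⟨ ≡.cong (λ k → term 0 + term k) (toℕ-fromℕ p) ⟩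
      term 0 + term p                  ≈⟨ +-cong term₀ termₚ ⟩
      y ^ᶠ p + x ^ᶠ p                  ≈⟨ +-comm _ _ ⟩
      x ^ᶠ p + y ^ᶠ p                  ∎
      where
      term : ℕ → Carrier
      term k = (p C k) ×ₙ (x ^ˢ k * y ^ˢ (p ∸ k))
      middle≈0 : ∀ (i : Fin (suc p)) → 0 < toℕ i → toℕ i < p → term (toℕ i) ≈ 0#
      middle≈0 i 0<i i<p = ×1≈0⇒×≈0 {p C toℕ i} (binomial×1≈0 0<i i<p) _
      term₀ : term 0 ≈ y ^ᶠ p
      term₀ = trans (+-identityʳ _) (trans (*-identityˡ _) (sym (^ᶠ≈^ y p)))
      termₚ : term p ≈ x ^ᶠ p
      termₚ = begin
        (p C p) ×ₙ (x ^ˢ p * y ^ˢ (p ∸ p))   ≡⟨ ≡.cong₂ (λ n k → n ×ₙ (x ^ˢ p * y ^ˢ k)) (nCn≡1 p) (ℕ.n∸n≡0 p) ⟩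
        x ^ˢ p * 1# + 0#                     ≈⟨ trans (+-identityʳ _) (*-identityʳ _) ⟩
        x ^ˢ p                               ≈⟨ ^ᶠ≈^ x p ⟨
        x ^ᶠ p                               ∎

    frobenius^ : ∀ r x y → (x + y) ^ᶠ (p ^ r) ≈ x ^ᶠ (p ^ r) + y ^ᶠ (p ^ r)
    frobenius^ zero    x y = trans (*-identityʳ _) (sym (+-cong (*-identityʳ x) (*-identityʳ y)))
    frobenius^ (suc r) x y = begin
      (x + y) ^ᶠ (p ℕ.* p ^ r)                    ≈⟨ ^ᶠ-assocʳ (x + y) p (p ^ r) ⟨
      ((x + y) ^ᶠ p) ^ᶠ (p ^ r)                    ≈⟨ ^ᶠ-congˡ (p ^ r) (frobenius x y) ⟩
      (x ^ᶠ p + y ^ᶠ p) ^ᶠ (p ^ r)                 ≈⟨ frobenius^ r (x ^ᶠ p) (y ^ᶠ p) ⟩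
      (x ^ᶠ p) ^ᶠ (p ^ r) + (y ^ᶠ p) ^ᶠ (p ^ r)    ≈⟨ +-cong (^ᶠ-assocʳ x p (p ^ r)) (^ᶠ-assocʳ y p (p ^ r)) ⟩
      x ^ᶠ (p ℕ.* p ^ r) + y ^ᶠ (p ℕ.* p ^ r)      ∎

module FieldFacts {c ℓ} (F : CommutativeRing c ℓ) (isField : IsField F) where
  open CommutativeRing F hiding (zero)
  open IsField isField
  open FieldNotions F using (_^ᶠ_; CubeRootOfUnity)
  open import Algebra.Properties.Ring ring using (x∙y⁻¹≈ε⇒x≈y; x≈y⇒x∙y⁻¹≈ε; x[y-z]≈xy-xz; +-cancelʳ)
  open import Algebra.Properties.Semiring.Mult semiring using () renaming (_×_ to _×ₙ_)
  open import Relation.Binary.Reasoning.Setoid setoid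
  open import Algebra.Solver.Ring.NaturalCoefficients.Default commutativeSemiring

  x*y≈0⇒y≈0 : ∀ {x y} → ¬ x ≈ 0# → x * y ≈ 0# → y ≈ 0#
  x*y≈0⇒y≈0 {x} {y} x≉0 xy≈0 = begin
    y                  ≈⟨ *-identityˡ y ⟨
    1# * y             ≈⟨ *-congʳ x*x⁻¹≈1 ⟨
    (x * x⁻¹) * y      ≈⟨ solve 3 (λ x x⁻¹ y → (x :* x⁻¹) :* y := x⁻¹ :* (x :* y)) refl x x⁻¹ y ⟩
    x⁻¹ * (x * y)      ≈⟨ *-congˡ xy≈0 ⟩
    x⁻¹ * 0#           ≈⟨ zeroʳ x⁻¹ ⟩
    0#                 ∎
    where
    x⁻¹ = proj₁ (inverse x x≉0)
    x*x⁻¹≈1 = proj₂ (inverse x x≉0)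

  *-≉0 : ∀ {x y} → ¬ x ≈ 0# → ¬ y ≈ 0# → ¬ x * y ≈ 0#
  *-≉0 x≉0 y≉0 = y≉0 ∘ x*y≈0⇒y≈0 x≉0

  ^ᶠ-≉0 : ∀ n {x} → ¬ x ≈ 0# → ¬ x ^ᶠ n ≈ 0#
  ^ᶠ-≉0 zero    _   = 0≉1 ∘ sym
  ^ᶠ-≉0 (suc n) x≉0 = *-≉0 x≉0 (^ᶠ-≉0 n x≉0)

  x*y≈0⇒⊎ : ∀ {x y} → Dec (x ≈ 0#) → x * y ≈ 0# → x ≈ 0# ⊎ y ≈ 0#
  x*y≈0⇒⊎ (yes x≈0) _    = inj₁ x≈0
  x*y≈0⇒⊎ (no  x≉0) xy≈0 = inj₂ (x*y≈0⇒y≈0 x≉0 xy≈0)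

  x≉y∧zx≈zy⇒z≈0 : ∀ {x y z} → ¬ x ≈ y → z * x ≈ z * y → z ≈ 0#
  x≉y∧zx≈zy⇒z≈0 {x} {y} {z} x≉y zx≈zy = x*y≈0⇒y≈0 (x≉y ∘ x∙y⁻¹≈ε⇒x≈y x y) (begin
    (x - y) * z        ≈⟨ *-comm (x - y) z ⟩
    z * (x - y)        ≈⟨ x[y-z]≈xy-xz z x y ⟩
    z * x - z * y      ≈⟨ x≈y⇒x∙y⁻¹≈ε zx≈zy ⟩
    0#                 ∎)

  *-cancelˡ : ∀ {x y z} → ¬ x ≈ 0# → x * y ≈ x * z → y ≈ z
  *-cancelˡ {x} {y} {z} x≉0 xy≈xz = x∙y⁻¹≈ε⇒x≈y y z (x*y≈0⇒y≈0 x≉0 (begin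
    x * (y - z)        ≈⟨ x[y-z]≈xy-xz x y z ⟩
    x * y - x * z      ≈⟨ x≈y⇒x∙y⁻¹≈ε xy≈xz ⟩
    0#                 ∎))

  Φ₃ : Carrier → Carrier
  Φ₃ y = y * y + y + 1#

  -- (a + b)(a + c)(a + d) = a²(a + b + c + d) + abcd(a′ + b′ + c′ + d′)
  reciprocal-pairing : ∀ {a b c d a′ b′ c′ d′} →
    a * a′ ≈ 1# → b * b′ ≈ 1# → c * c′ ≈ 1# → d * d′ ≈ 1# →
    a + (b + (c + (d + 0#))) ≈ 0# → a′ + (b′ + (c′ + (d′ + 0#))) ≈ 0# →
    (a + b) * ((a + c) * (a + d)) ≈ 0#
  reciprocal-pairing {a} {b} {c} {d} {a′} {b′} {c′} {d′} aa′≈1 bb′≈1 cc′≈1 dd′≈1 S≈0 S′≈0 = begin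
    (a + b) * ((a + c) * (a + d))
      ≈⟨ solve 4 (λ a b c d → (a :+ b) :* ((a :+ c) :* (a :+ d))
                           := (a :* a) :* (a :+ (b :+ (c :+ (d :+ con 0))))
                              :+ (b :* c :* d :* con 1 :+ a :* c :* d :* con 1 :+ a :* b :* d :* con 1 :+ a :* b :* c :* con 1))
                  refl a b c d ⟩
    (a * a) * S + (b * c * d * 1# + a * c * d * 1# + a * b * d * 1# + a * b * c * 1#)
      ≈⟨ +-congˡ (+-cong (+-cong (+-cong (*-congˡ (sym aa′≈1)) (*-congˡ (sym bb′≈1))) (*-congˡ (sym cc′≈1))) (*-congˡ (sym dd′≈1))) ⟩
    (a * a) * S + (b * c * d * (a * a′) + a * c * d * (b * b′) + a * b * d * (c * c′) + a * b * c * (d * d′))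
      ≈⟨ +-congˡ (solve 8 (λ a b c d a′ b′ c′ d′ →
                   b :* c :* d :* (a :* a′) :+ a :* c :* d :* (b :* b′) :+ a :* b :* d :* (c :* c′) :+ a :* b :* c :* (d :* d′)
                   := (a :* b :* c :* d) :* (a′ :+ (b′ :+ (c′ :+ (d′ :+ con 0)))))
                  refl a b c d a′ b′ c′ d′) ⟩
    (a * a) * S + (a * b * c * d) * S′
      ≈⟨ +-cong (*-congˡ S≈0) (*-congˡ S′≈0) ⟩
    (a * a) * 0# + (a * b * c * d) * 0#
      ≈⟨ trans (+-cong (zeroʳ _) (zeroʳ _)) (+-identityˡ 0#) ⟩
    0# ∎
    where
    S  = a + (b + (c + (d + 0#)))
    S′ = a′ + (b′ + (c′ + (d′ + 0#)))

  reciprocal-triple⇒Φ₃≈0 : ∀ {y z y′ z′} → y * y′ ≈ 1# → z * z′ ≈ 1# →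
    1# + (y + z) ≈ 0# → 1# + (y′ + z′) ≈ 0# → Φ₃ y ≈ 0#
  reciprocal-triple⇒Φ₃≈0 {y} {z} {y′} {z′} yy′≈1 zz′≈1 S≈0 S′≈0 = begin
    y * y + y + 1#           ≈⟨ +-congˡ yz≈1 ⟨
    y * y + y + y * z        ≈⟨ solve 2 (λ y z → y :* y :+ y :+ y :* z := y :* (con 1 :+ (y :+ z))) refl y z ⟩
    y * (1# + (y + z))       ≈⟨ *-congˡ S≈0 ⟩
    y * 0#                   ≈⟨ zeroʳ y ⟩
    0#                       ∎
    where
    yz≈1 : y * z ≈ 1#
    yz≈1 = +-cancelʳ (y + z) (y * z) 1# (begin
      y * z + (y + z)                          ≈⟨ solve 2 (λ y z → y :* z :+ (y :+ z) := y :* z :+ (z :* con 1 :+ y :* con 1)) refl y z ⟩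
      y * z + (z * 1# + y * 1#)                ≈⟨ +-congˡ (+-cong (*-congˡ (sym yy′≈1)) (*-congˡ (sym zz′≈1))) ⟩
      y * z + (z * (y * y′) + y * (z * z′))    ≈⟨ solve 4 (λ y z y′ z′ → y :* z :+ (z :* (y :* y′) :+ y :* (z :* z′)) := (y :* z) :* (con 1 :+ (y′ :+ z′))) refl y z y′ z′ ⟩
      (y * z) * (1# + (y′ + z′))               ≈⟨ *-congˡ S′≈0 ⟩
      (y * z) * 0#                             ≈⟨ zeroʳ _ ⟩
      0#                                       ≈⟨ S≈0 ⟨
      1# + (y + z)                             ∎)

  Φ₃≈0⇒cube≈1 : ∀ {y} → Φ₃ y ≈ 0# → CubeRootOfUnity y
  Φ₃≈0⇒cube≈1 {y} Φ₃y≈0 = +-cancelʳ (Φ₃ y) (y ^ᶠ 3) 1# (begin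
    y ^ᶠ 3 + Φ₃ y     ≈⟨ solve 1 (λ y → y :* (y :* (y :* con 1)) :+ (y :* y :+ y :+ con 1) := y :* (y :* y :+ y :+ con 1) :+ con 1) refl y ⟩
    y * Φ₃ y + 1#     ≈⟨ +-congʳ (trans (*-congˡ Φ₃y≈0) (zeroʳ y)) ⟩
    0# + 1#           ≈⟨ +-comm 0# 1# ⟩
    1# + 0#           ≈⟨ +-congˡ Φ₃y≈0 ⟨
    1# + Φ₃ y         ∎)

  Φ₃-root≈1⇒3≈0 : ∀ {y} → Φ₃ y ≈ 0# → y ≈ 1# → 3 ×ₙ 1# ≈ 0#
  Φ₃-root≈1⇒3≈0 {y} Φ₃y≈0 y≈1 = begin
    3 ×ₙ 1#     ≈⟨ solve 0 (con 1 :+ (con 1 :+ (con 1 :+ con 0)) := con 1 :* con 1 :+ con 1 :+ con 1) refl ⟩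
    Φ₃ 1#       ≈⟨ +-congʳ (+-cong (*-cong y≈1 y≈1) y≈1) ⟨
    Φ₃ y        ≈⟨ Φ₃y≈0 ⟩
    0#          ∎

  Φ₃-roots-distinct : ∀ {y z} → ¬ 3 ×ₙ 1# ≈ 0# → Φ₃ y ≈ 0# → 1# + (y + z) ≈ 0# → ¬ y ≈ z
  Φ₃-roots-distinct {y} {z} 3≉0 Φ₃y≈0 S≈0 y≈z = 3≉0 (+-cancelʳ (w * w) (3 ×ₙ 1#) 0# (begin
    3 ×ₙ 1# + w * w                    ≈⟨ solve 1 (λ y → con 1 :+ (con 1 :+ (con 1 :+ con 0)) :+ (con 1 :+ (y :+ y)) :* (con 1 :+ (y :+ y))
                                                   := (con 1 :+ (con 1 :+ (con 1 :+ (con 1 :+ con 0)))) :* (y :* y :+ y :+ con 1)) refl y ⟩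
    4 ×ₙ 1# * Φ₃ y                     ≈⟨ *-congˡ Φ₃y≈0 ⟩
    4 ×ₙ 1# * 0#                       ≈⟨ zeroʳ _ ⟩
    0#                                 ≈⟨ +-identityˡ 0# ⟨
    0# + 0#                            ≈⟨ +-congˡ (trans (*-congˡ w≈0) (zeroʳ w)) ⟨
    0# + w * w                         ∎))
    where
    w = 1# + (y + y)
    w≈0 : w ≈ 0#
    w≈0 = trans (+-congˡ (+-congˡ y≈z)) S≈0

  cube-roots-sum≈0 : ∀ {a b c} → CubeRootOfUnity a → CubeRootOfUnity b → CubeRootOfUnity c →
    ¬ a ≈ b → ¬ a ≈ c → ¬ b ≈ c → a + (b + c) ≈ 0#
  cube-roots-sum≈0 {a} {b} {c} a³≈1 b³≈1 c³≈1 a≉b a≉c b≉c =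
    x≉y∧zx≈zy⇒z≈0 b≉c (+-cancelʳ (Q a c) _ _ (begin
      (a + (b + c)) * b + Q a c    ≈⟨ solve 3 (λ a b c → (a :+ (b :+ c)) :* b :+ (a :* a :+ a :* c :+ c :* c)
                                                     := (a :+ (b :+ c)) :* c :+ (a :* a :+ a :* b :+ b :* b)) refl a b c ⟩
      (a + (b + c)) * c + Q a b    ≈⟨ +-congˡ (trans (Q≈0 a³≈1 b³≈1 a≉b) (sym (Q≈0 a³≈1 c³≈1 a≉c))) ⟩
      (a + (b + c)) * c + Q a c    ∎))
    where
    Q : Carrier → Carrier → Carrier
    Q x y = x * x + x * y + y * y
    Q≈0 : ∀ {x y} → CubeRootOfUnity x → CubeRootOfUnity y → ¬ x ≈ y → Q x y ≈ 0#
    Q≈0 {x} {y} x³≈1 y³≈1 x≉y = x≉y∧zx≈zy⇒z≈0 x≉y (begin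
      Q x y * x                        ≈⟨ solve 2 (λ x y → (x :* x :+ x :* y :+ y :* y) :* x
                                                     := x :* (x :* (x :* con 1)) :+ (x :* x :* y :+ x :* y :* y)) refl x y ⟩
      x ^ᶠ 3 + (x * x * y + x * y * y)  ≈⟨ +-congʳ (trans x³≈1 (sym y³≈1)) ⟩
      y ^ᶠ 3 + (x * x * y + x * y * y)  ≈⟨ solve 2 (λ x y → y :* (y :* (y :* con 1)) :+ (x :* x :* y :+ x :* y :* y)
                                                     := (x :* x :+ x :* y :+ y :* y) :* y) refl x y ⟩
      Q x y * y                        ∎)

module FiniteFieldFacts {c ℓ} (F : CommutativeRing c ℓ) (isField : IsField F) {N} (card : HasCardinality F N) where
  open CommutativeRing F hiding (zero)
  open IsField isField
  open FieldNotions F using (_^ᶠ_)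
  open FieldFacts F isField
  open Inverse card
  open import Algebra.Properties.Semiring.Mult semiring using () renaming (_×_ to _×ₙ_)
  open import Relation.Binary.Reasoning.Setoid setoid
  open import Algebra.Properties.Ring ring using (+-cancelˡ; +-cancelʳ)
  module Σ = SumReindexing +-commutativeMonoid
  module Π = SumReindexing *-commutativeMonoid
  open import Algebra.Properties.CommutativeMonoid.Sum +-commutativeMonoid using (sum; ∑-distrib-+; sum-replicate)
  import Algebra.Properties.CommutativeMonoid.Sum *-commutativeMonoid as Prod

  infix 4 _≟_
  _≟_ : Decidable _≈_
  x ≟ y with to x Fin.≟ to y
  ... | yes tx≡ty = yes (trans (sym (strictlyInverseʳ x)) (trans (from-cong tx≡ty) (strictlyInverseʳ y)))
  ... | no  tx≢ty = no (tx≢ty ∘ to-cong)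

  N×x≈0 : ∀ x → N ×ₙ x ≈ 0#
  N×x≈0 x = +-cancelʳ (sum from) (N ×ₙ x) 0# (begin
    N ×ₙ x + sum from                ≈⟨ +-congʳ (sum-replicate N) ⟨
    sum {N} (λ _ → x) + sum from      ≈⟨ ∑-distrib-+ (λ _ → x) from ⟨
    sum {N} (λ i → x + from i)        ≈⟨ Σ.sum-elements-reindex card (λ x≈y → x≈y) (+-cancelˡ x _ _) ⟩
    sum from                          ≈⟨ +-identityˡ _ ⟨
    0# + sum from                     ∎)

  orOne : Carrier → Carrier
  orOne z with z ≟ 0#
  ... | yes _ = 1#
  ... | no  _ = z

  ifZero : Carrier → Carrier → Carrier
  ifZero x z with z ≟ 0#
  ... | yes _ = x
  ... | no  _ = 1#

  orOne-cong : ∀ {y z} → y ≈ z → orOne y ≈ orOne z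
  orOne-cong {y} {z} y≈z with y ≟ 0# | z ≟ 0#
  ... | yes _   | yes _   = refl
  ... | no  _   | no  _   = y≈z
  ... | yes y≈0 | no  z≉0 = contradiction (trans (sym y≈z) y≈0) z≉0
  ... | no  y≉0 | yes z≈0 = contradiction (trans y≈z z≈0) y≉0

  orOne≉0 : ∀ z → ¬ orOne z ≈ 0#
  orOne≉0 z with z ≟ 0#
  ... | yes _   = 0≉1 ∘ sym
  ... | no  z≉0 = z≉0

  orOne-* : ∀ {x} z → ¬ x ≈ 0# → orOne (x * z) * ifZero x z ≈ orOne z * x
  orOne-* {x} z x≉0 with (x * z) ≟ 0# | z ≟ 0#
  ... | yes _    | yes _   = refl
  ... | no  _    | no  _   = trans (*-identityʳ _) (*-comm x z)
  ... | yes xz≈0 | no  z≉0 = contradiction xz≈0 (*-≉0 x≉0 z≉0)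
  ... | no  xz≉0 | yes z≈0 = contradiction (trans (*-congˡ z≈0) (zeroʳ x)) xz≉0

  ∏≉0 : ∀ {n} (f : Fin n → Carrier) → (∀ i → ¬ f i ≈ 0#) → ¬ Prod.sum f ≈ 0#
  ∏≉0 {zero}  f _      = 0≉1 ∘ sym
  ∏≉0 {suc n} f f≉0 = *-≉0 (f≉0 zero) (∏≉0 (f ∘ suc) (f≉0 ∘ suc))

  ∏-const : ∀ n x → Prod.sum {n} (λ _ → x) ≈ x ^ᶠ n
  ∏-const zero    x = refl
  ∏-const (suc n) x = *-congˡ (∏-const n x)

  ∏ifZero≈x : ∀ x → Prod.sum (ifZero x ∘ from) ≈ x
  ∏ifZero≈x x = trans (Π.sum-single (ifZero x ∘ from) (to 0#) elsewhere) at-zero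
    where
    at-zero : ifZero x (from (to 0#)) ≈ x
    at-zero with from (to 0#) ≟ 0#
    ... | yes _  = refl
    ... | no  ≉0 = contradiction (strictlyInverseʳ 0#) ≉0
    elsewhere : ∀ i → i ≢ to 0# → ifZero x (from i) ≈ 1#
    elsewhere i i≢to0 with from i ≟ 0#
    ... | no  _  = refl
    ... | yes ≈0 = contradiction (≡.trans (≡.sym (strictlyInverseˡ i)) (to-cong ≈0)) i≢to0

  -- Multiplication by x permutes F. Replacing 0 by 1 (orOne) makes the product over all of F
  -- nonzero, and ifZero x records the factor x lost at 0; hence x ^ N = ∏ ifZero x = x.
  x^N≈x : ∀ {x} → ¬ x ≈ 0# → x ^ᶠ N ≈ x
  x^N≈x {x} x≉0 = *-cancelˡ P≉0 (begin
    P * x ^ᶠ N                                                    ≈⟨ *-congˡ (∏-const N x) ⟨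
    P * Prod.sum {N} (λ _ → x)                                    ≈⟨ Prod.∑-distrib-+ (orOne ∘ from) (λ _ → x) ⟨
    Prod.sum (λ i → orOne (from i) * x)                           ≈⟨ Prod.sum-cong-≋ (λ i → orOne-* (from i) x≉0) ⟨
    Prod.sum (λ i → orOne (x * from i) * ifZero x (from i))       ≈⟨ Prod.∑-distrib-+ (orOne ∘ (x *_) ∘ from) (ifZero x ∘ from) ⟩
    Prod.sum (orOne ∘ (x *_) ∘ from) * Prod.sum (ifZero x ∘ from) ≈⟨ *-cong (Π.sum-elements-reindex card orOne-cong (*-cancelˡ x≉0)) (∏ifZero≈x x) ⟩
    P * x                                                         ∎)
    where
    P = Prod.sum (orOne ∘ from)
    P≉0 = ∏≉0 (orOne ∘ from) (orOne≉0 ∘ from)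

punchIn-elim : ∀ {n a} {P : Fin (suc n) → Set a} i → (∀ m → P (punchIn i m)) → ∀ j → j ≢ i → P j
punchIn-elim {P = P} i P-punchIn j j≢i = ≡.subst P (punchIn-punchOut (j≢i ∘ ≡.sym)) (P-punchIn _)

distinct⇒injective : ∀ {i j k l : Fin 4} → i ≢ j → i ≢ k → i ≢ l → j ≢ k → j ≢ l → k ≢ l →
                     Injective _≡_ _≡_ (i ∷ j ∷ k ∷ l ∷ [])
distinct⇒injective i≢j i≢k i≢l j≢k j≢l k≢l = injective
  where
  injective : Injective _≡_ _≡_ _
  injective {0F} {0F} _ = ≡.refl
  injective {1F} {1F} _ = ≡.refl
  injective {2F} {2F} _ = ≡.refl
  injective {3F} {3F} _ = ≡.refl
  injective {0F} {1F} e = contradiction e i≢j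
  injective {0F} {2F} e = contradiction e i≢k
  injective {0F} {3F} e = contradiction e i≢l
  injective {1F} {2F} e = contradiction e j≢k
  injective {1F} {3F} e = contradiction e j≢l
  injective {2F} {3F} e = contradiction e k≢l
  injective {1F} {0F} e = contradiction (≡.sym e) i≢j
  injective {2F} {0F} e = contradiction (≡.sym e) i≢k
  injective {3F} {0F} e = contradiction (≡.sym e) i≢l
  injective {2F} {1F} e = contradiction (≡.sym e) j≢k
  injective {3F} {1F} e = contradiction (≡.sym e) j≢l
  injective {3F} {2F} e = contradiction (≡.sym e) k≢l

module FermatSurface {c ℓ} (F : CommutativeRing c ℓ) (isField : IsField F)
                     {p r : ℕ} (p-prime : Prime p) (r≥1 : r ≥ 1)
                     (card : HasCardinality F ((p ^ r) ^ 2)) where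
  open CommutativeRing F hiding (zero)
  open IsField isField
  open FieldNotions F
  open RingFacts F
  open FieldFacts F isField
  open FiniteFieldFacts F isField card
  open Arithmetic
    using (prime⇒≥2; prime^%3≡0⇔≡3; prime≢3⇒%3≢0; 1+[n∸1]+[n∸1]n≡n²; n≡1+[n∸1]; n∸1≡1+[n∸2])
  open import Algebra.Properties.Ring ring using (+-inverseˡ-unique)
  open import Algebra.Properties.Semiring.Mult semiring using () renaming (_×_ to _×ₙ_)
  open import Algebra.Properties.CommutativeMonoid.Sum +-commutativeMonoid using (sum; sum-cong-≋; sum-permute)
  open import Algebra.Properties.Semiring.Sum semiring using (*-distribˡ-sum)
  open SumReindexing +-commutativeMonoid using (sum-reindex)
  open import Relation.Binary.Reasoning.Setoid setoid
  open import Algebra.Solver.Ring.NaturalCoefficients.Default commutativeSemiring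

  q : ℕ
  q = p ^ r

  char-p : p ×ₙ 1# ≈ 0#
  char-p with p ×ₙ 1# ≟ 0#
  ... | yes p≈0 = p≈0
  ... | no  p≉0 = contradiction (begin
    ((p ×ₙ 1#) ^ᶠ r) ^ᶠ 2  ≈⟨ ^ᶠ-congˡ 2 (×1-homo-^ p r) ⟨
    (q ×ₙ 1#) ^ᶠ 2         ≈⟨ ×1-homo-^ q 2 ⟨
    (q ^ 2) ×ₙ 1#          ≈⟨ N×x≈0 1# ⟩
    0#                     ∎) (^ᶠ-≉0 2 (^ᶠ-≉0 r p≉0))

  open Frobenius p-prime char-p using (frobenius^)

  3≈0 : q % 3 ≡ 0 → 3 ×ₙ 1# ≈ 0#
  3≈0 q%3≡0 = ≡.subst (λ n → n ×ₙ 1# ≈ 0#) (Equivalence.to (prime^%3≡0⇔≡3 r p-prime r≥1) q%3≡0) char-p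

  3≉0 : q % 3 ≢ 0 → ¬ 3 ×ₙ 1# ≈ 0#
  3≉0 q%3≢0 3≈0 = by-residue (p % 3) (m%n<n p 3) (prime≢3⇒%3≢0 p-prime p≢3) (trans (sym (×1-mod 3≈0 p)) char-p)
    where
    p≢3 : p ≢ 3
    p≢3 = q%3≢0 ∘ Equivalence.from (prime^%3≡0⇔≡3 r p-prime r≥1)
    by-residue : ∀ s → s ℕ.< 3 → s ≢ 0 → s ×ₙ 1# ≈ 0# → ⊥
    by-residue 0 _ 0≢0 _ = 0≢0 ≡.refl
    by-residue 1 _ _ 1≈0 = 0≉1 (sym (trans (sym (+-identityʳ 1#)) 1≈0))
    by-residue 2 _ _ 2≈0 = 0≉1 (sym (trans (sym (+-identityʳ 1#)) (trans (+-congˡ (sym 2≈0)) 3≈0)))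
    by-residue (suc (suc (suc _))) (s≤s (s≤s (s≤s ())))

  q%3≡2⇒3≉0 : q % 3 ≡ 2 → ¬ 3 ×ₙ 1# ≈ 0#
  q%3≡2⇒3≉0 q%3≡2 = 3≉0 (λ q%3≡0 → contradiction (≡.trans (≡.sym q%3≡2) q%3≡0) λ ())

  3≈0⇒q%3≡0 : 3 ×ₙ 1# ≈ 0# → q % 3 ≡ 0
  3≈0⇒q%3≡0 3≈0 with q % 3 ℕ.≟ 0
  ... | yes q%3≡0 = q%3≡0
  ... | no  q%3≢0 = contradiction 3≈0 (3≉0 q%3≢0)

  q≥2 : 2 ℕ.≤ q
  q≥2 = ℕ.≤-trans (≡.subst (2 ℕ.≤_) (≡.sym (ℕ.*-identityʳ p)) (prime⇒≥2 p-prime))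
                  (ℕ.^-monoʳ-≤ p {{prime⇒nonZero p-prime}} r≥1)

  q≡1+[q∸1] : q ≡ suc (q ∸ 1)
  q≡1+[q∸1] = n≡1+[n∸1] (ℕ.<⇒≤ q≥2)

  q∸1≡1+[q∸2] : q ∸ 1 ≡ suc (q ∸ 2)
  q∸1≡1+[q∸2] = n∸1≡1+[n∸2] q≥2

  0^q≈0 : 0# ^ᶠ q ≈ 0#
  0^q≈0 = trans (reflexive (≡.cong (0# ^ᶠ_) q≡1+[q∸1])) (zeroˡ _)

  frobenius-sum : ∀ {n} (f : Fin n → Carrier) → sum f ^ᶠ q ≈ sum (λ i → f i ^ᶠ q)
  frobenius-sum {zero}  f = 0^q≈0
  frobenius-sum {suc n} f = trans (frobenius^ r _ _) (+-congˡ (frobenius-sum (f ∘ suc)))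

  ν : Carrier → Carrier
  ν x = x ^ᶠ (q ∸ 1)

  ν-cong : ∀ {x y} → x ≈ y → ν x ≈ ν y
  ν-cong = ^ᶠ-congˡ (q ∸ 1)

  ν-* : ∀ x y → ν (x * y) ≈ ν x * ν y
  ν-* x y = ^ᶠ-distrib-* x y (q ∸ 1)

  ν-1 : ν 1# ≈ 1#
  ν-1 = 1^ᶠ (q ∸ 1)

  ν-≈0 : ∀ {x} → x ≈ 0# → ν x ≈ 0#
  ν-≈0 {x} x≈0 = trans (reflexive (≡.cong (x ^ᶠ_) q∸1≡1+[q∸2])) (trans (*-congʳ x≈0) (zeroˡ _))

  ν-≉0 : ∀ {x} → ¬ x ≈ 0# → ¬ ν x ≈ 0#
  ν-≉0 = ^ᶠ-≉0 (q ∸ 1)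

  x^q≈x*νx : ∀ x → x ^ᶠ q ≈ x * ν x
  x^q≈x*νx x = reflexive (≡.cong (x ^ᶠ_) q≡1+[q∸1])

  ν-reciprocal : ∀ {x} → ¬ x ≈ 0# → ν x * ν x ^ᶠ q ≈ 1#
  ν-reciprocal {x} x≉0 = *-cancelˡ x≉0 (begin
    x * (ν x * ν x ^ᶠ q)                        ≈⟨ *-congˡ (*-congˡ (^ᶠ-assocʳ x (q ∸ 1) q)) ⟩
    x * (ν x * x ^ᶠ ((q ∸ 1) ℕ.* q))            ≈⟨ *-congˡ (^ᶠ-homo-* x (q ∸ 1) ((q ∸ 1) ℕ.* q)) ⟨
    x ^ᶠ suc ((q ∸ 1) ℕ.+ (q ∸ 1) ℕ.* q)        ≡⟨ ≡.cong (x ^ᶠ_) (1+[n∸1]+[n∸1]n≡n² q (ℕ.<⇒≤ q≥2)) ⟩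
    x ^ᶠ (q ^ 2)                                ≈⟨ x^N≈x x≉0 ⟩
    x                                           ≈⟨ *-identityʳ x ⟨
    x * 1#                                      ∎)

  ν≈1⇒subfield : ∀ {x} → ν x ≈ 1# → InSubfield q x
  ν≈1⇒subfield {x} νx≈1 = trans (x^q≈x*νx x) (trans (*-congˡ νx≈1) (*-identityʳ x))

  subfield⇒ν≈1 : ∀ {x} → ¬ x ≈ 0# → InSubfield q x → ν x ≈ 1#
  subfield⇒ν≈1 {x} x≉0 x^q≈x = *-cancelˡ x≉0 (trans (sym (x^q≈x*νx x)) (trans x^q≈x (sym (*-identityʳ x))))

  0∈subfield : ∀ {x} → x ≈ 0# → InSubfield q x
  0∈subfield {x} x≈0 = trans (x^q≈x*νx x) (trans (*-congʳ x≈0) (trans (zeroˡ _) (sym x≈0)))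

  Φ₃[ν]≈0 : ∀ {x y} → ¬ x ≈ 0# → ¬ y ≈ 0# → 1# + (ν x + ν y) ≈ 0# → Φ₃ (ν x) ≈ 0#
  Φ₃[ν]≈0 {x} {y} x≉0 y≉0 S≈0 = reciprocal-triple⇒Φ₃≈0 (ν-reciprocal x≉0) (ν-reciprocal y≉0) S≈0 (begin
    1# + (ν x ^ᶠ q + ν y ^ᶠ q)    ≈⟨ +-cong (1^ᶠ q) (frobenius^ r (ν x) (ν y)) ⟨
    1# ^ᶠ q + (ν x + ν y) ^ᶠ q    ≈⟨ frobenius^ r 1# (ν x + ν y) ⟨
    (1# + (ν x + ν y)) ^ᶠ q       ≈⟨ ^ᶠ-congˡ q S≈0 ⟩
    0# ^ᶠ q                       ≈⟨ 0^q≈0 ⟩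
    0#                            ∎)

  ν-cube-root≈1 : ∀ {x} → ¬ x ≈ 0# → Φ₃ (ν x) ≈ 0# → q % 3 ≢ 2 → ν x ≈ 1#
  ν-cube-root≈1 x≉0 Φ₃≈0 = cube-root≈1 q (Φ₃≈0⇒cube≈1 Φ₃≈0) (ν-reciprocal x≉0)

  surface≈sum : ∀ (a : Fin 4 → Carrier) → a 0F + a 1F + a 2F + a 3F ≈ sum a
  surface≈sum a = solve 4 (λ a b c d → a :+ b :+ c :+ d := a :+ (b :+ (c :+ (d :+ con 0)))) refl (a 0F) (a 1F) (a 2F) (a 3F)

  onSurface⇔sum : ∀ u → OnSurface q u ⇔ sum (ν ∘ u) ≈ 0#
  onSurface⇔sum u = mk⇔ (trans (sym (surface≈sum (ν ∘ u)))) (trans (surface≈sum (ν ∘ u)))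

  sum-ν-scale : ∀ w u → sum (ν ∘ scale w u) ≈ ν w * sum (ν ∘ u)
  sum-ν-scale w u = trans (sum-cong-≋ (λ i → ν-* w (u i))) (sym (*-distribˡ-sum (ν w) (ν ∘ u)))

  sum-permute₄ : ∀ (a : Fin 4 → Carrier) (σ : Permutation′ 4) → sum a ≈ a (σ ⟨$⟩ʳ 0F) + (a (σ ⟨$⟩ʳ 1F) + (a (σ ⟨$⟩ʳ 2F) + a (σ ⟨$⟩ʳ 3F)))
  sum-permute₄ a σ = trans (sum-permute a σ) (+-congˡ (+-congˡ (+-congˡ (+-identityʳ _))))

  Forms : Coords → Set (c ⊔ ℓ)
  Forms u = PointOfForm (Form1 q) u
          ⊎ ((q % 3 ≡ 2) × PointOfForm (Form2 q) u)
          ⊎ ((q % 3 ≡ 0) × PointOfForm (Form3 q) u)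

  -- insert 0F i π sends 0F to i and suc m to punchIn i (π ⟨$⟩ʳ m), definitionally.
  isolate : Fin 4 → Permutation′ 4
  isolate i = insert 0F i id

  pairUp : Fin 4 → Fin 3 → Permutation′ 4
  pairUp i m = insert 0F i (insert 0F m id)

  module _ {u : Coords} (u≢0 : NonZeroTuple u) (S≈0 : sum (ν ∘ u) ≈ 0#) where

    form1 : (σ : Permutation′ 4) → ν (u (σ ⟨$⟩ʳ 0F)) + ν (u (σ ⟨$⟩ʳ 1F)) ≈ 0# → PointOfForm (Form1 q) u
    form1 σ first≈0 = 1# , 0≉1 ∘ sym , nonzero , σ , pair first≈0 , pair second≈0
      where
      a : Fin 4 → Carrier
      a = ν ∘ u ∘ (σ ⟨$⟩ʳ_)
      second≈0 : a 2F + a 3F ≈ 0#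
      second≈0 = begin
        a 2F + a 3F                      ≈⟨ +-identityˡ _ ⟨
        0# + (a 2F + a 3F)               ≈⟨ +-congʳ first≈0 ⟨
        (a 0F + a 1F) + (a 2F + a 3F)    ≈⟨ +-assoc _ _ _ ⟩
        a 0F + (a 1F + (a 2F + a 3F))    ≈⟨ sum-permute₄ (ν ∘ u) σ ⟨
        sum (ν ∘ u)                      ≈⟨ S≈0 ⟩
        0#                               ∎
      pair : ∀ {i j} → ν (u i) + ν (u j) ≈ 0# → ν (1# * u i) ≈ - ν (1# * u j)
      pair s = trans (ν-cong (*-identityˡ _)) (trans (+-inverseˡ-unique _ _ s) (-‿cong (ν-cong (sym (*-identityˡ _)))))
      nonzero : NonZeroTuple (scale 1# u)
      nonzero all≈0 = u≢0 (λ m → trans (sym (*-identityˡ (u m))) (all≈0 m))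

    pairing≈0 : (∀ i → ¬ u i ≈ 0#) →
      (ν (u 0F) + ν (u 1F)) * ((ν (u 0F) + ν (u 2F)) * (ν (u 0F) + ν (u 3F))) ≈ 0#
    pairing≈0 u≉0 = reciprocal-pairing
      (ν-reciprocal (u≉0 0F)) (ν-reciprocal (u≉0 1F)) (ν-reciprocal (u≉0 2F)) (ν-reciprocal (u≉0 3F))
      S≈0 (trans (sym (frobenius-sum (ν ∘ u))) (trans (^ᶠ-congˡ q S≈0) 0^q≈0))

    no-zero : (∀ i → ¬ u i ≈ 0#) → PointOfForm (Form1 q) u
    no-zero u≉0 =
      [ form1 (pairUp 0F 0F) , [ form1 (pairUp 0F 1F) , form1 (pairUp 0F 2F) ]′ ∘ x*y≈0⇒⊎ (ν (u 0F) + ν (u 2F) ≟ 0#) ]′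
        (x*y≈0⇒⊎ (ν (u 0F) + ν (u 1F) ≟ 0#) (pairing≈0 u≉0))

    module OneZero (i : Fin 4) (uᵢ≈0 : u i ≈ 0#) (others≉0 : ∀ m → ¬ u (punchIn i m) ≈ 0#) where
      j k l : Fin 4
      j = punchIn i 0F
      k = punchIn i 1F
      l = punchIn i 2F

      w : Carrier
      w = proj₁ (inverse (u j) (others≉0 0F))

      uⱼw≈1 : u j * w ≈ 1#
      uⱼw≈1 = proj₂ (inverse (u j) (others≉0 0F))

      w≉0 : ¬ w ≈ 0#
      w≉0 w≈0 = 0≉1 (trans (sym (trans (*-congˡ w≈0) (zeroʳ (u j)))) uⱼw≈1)

      v : Coords
      v = scale w u

      vᵢ≈0 : v i ≈ 0#
      vᵢ≈0 = trans (*-congˡ uᵢ≈0) (zeroʳ w)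

      v≉0 : ∀ m → ¬ v (punchIn i m) ≈ 0#
      v≉0 m = *-≉0 w≉0 (others≉0 m)

      νvⱼ≈1 : ν (v j) ≈ 1#
      νvⱼ≈1 = trans (ν-cong (trans (*-comm w (u j)) uⱼw≈1)) ν-1

      y z : Carrier
      y = ν (v k)
      z = ν (v l)

      1+y+z≈0 : 1# + (y + z) ≈ 0#
      1+y+z≈0 = begin
        1# + (y + z)                            ≈⟨ +-cong νvⱼ≈1 (+-congˡ (+-identityʳ z)) ⟨
        ν (v j) + (y + (z + 0#))                ≈⟨ +-identityˡ _ ⟨
        0# + (ν (v j) + (y + (z + 0#)))         ≈⟨ +-congʳ (ν-≈0 vᵢ≈0) ⟨
        ν (v i) + (ν (v j) + (y + (z + 0#)))    ≈⟨ sum-permute (ν ∘ v) (isolate i) ⟨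
        sum (ν ∘ v)                             ≈⟨ sum-ν-scale w u ⟩
        ν w * sum (ν ∘ u)                       ≈⟨ *-congˡ S≈0 ⟩
        ν w * 0#                                ≈⟨ zeroʳ _ ⟩
        0#                                      ∎

      Φ₃y≈0 : Φ₃ y ≈ 0#
      Φ₃y≈0 = Φ₃[ν]≈0 (v≉0 1F) (v≉0 2F) 1+y+z≈0

      Φ₃z≈0 : Φ₃ z ≈ 0#
      Φ₃z≈0 = Φ₃[ν]≈0 (v≉0 2F) (v≉0 1F) (trans (+-congˡ (+-comm z y)) 1+y+z≈0)

      exactlyOneZero : ExactlyOneZeroAt v i
      exactlyOneZero = vᵢ≈0 , punchIn-elim i v≉0

      form2 : q % 3 ≡ 2 → PointOfForm (Form2 q) u
      form2 q%3≡2 = w , w≉0 , i , j , k , l , exactlyOneZero ,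
        i≢punchIn 0F , i≢punchIn 1F , i≢punchIn 2F , (λ ()) ∘ punchIn-injective i 0F 1F ,
        (λ ()) ∘ punchIn-injective i 0F 2F , (λ ()) ∘ punchIn-injective i 1F 2F ,
        trans (^ᶠ-congˡ 3 νvⱼ≈1) (1^ᶠ 3) , Φ₃≈0⇒cube≈1 Φ₃y≈0 , Φ₃≈0⇒cube≈1 Φ₃z≈0 ,
        ≉1 Φ₃y≈0 ∘ (λ e → trans (sym e) νvⱼ≈1) , ≉1 Φ₃z≈0 ∘ (λ e → trans (sym e) νvⱼ≈1) ,
        Φ₃-roots-distinct (q%3≡2⇒3≉0 q%3≡2) Φ₃y≈0 1+y+z≈0
        where
        i≢punchIn : ∀ m → i ≢ punchIn i m
        i≢punchIn m = punchInᵢ≢i i m ∘ ≡.sym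
        ≉1 : ∀ {x} → Φ₃ x ≈ 0# → ¬ x ≈ 1#
        ≉1 Φ₃x≈0 = q%3≡2⇒3≉0 q%3≡2 ∘ Φ₃-root≈1⇒3≈0 Φ₃x≈0

      module _ (q%3≢2 : q % 3 ≢ 2) where
        y≈1 : y ≈ 1#
        y≈1 = ν-cube-root≈1 (v≉0 1F) Φ₃y≈0 q%3≢2

        q%3≡0 : q % 3 ≡ 0
        q%3≡0 = 3≈0⇒q%3≡0 (Φ₃-root≈1⇒3≈0 Φ₃y≈0 y≈1)

        form3 : PointOfForm (Form3 q) u
        form3 = w , w≉0 , subfield , i , exactlyOneZero
          where
          others≈1 : ∀ m → ν (v (punchIn i m)) ≈ 1#
          others≈1 0F = νvⱼ≈1
          others≈1 1F = y≈1
          others≈1 2F = ν-cube-root≈1 (v≉0 2F) Φ₃z≈0 q%3≢2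
          subfield : ∀ m → InSubfield q (v m)
          subfield m with m Fin.≟ i
          ... | yes ≡.refl = 0∈subfield vᵢ≈0
          ... | no  m≢i    = punchIn-elim i (ν≈1⇒subfield ∘ others≈1) m m≢i

      forms : Forms u
      forms = by-residue (q % 3 ℕ.≟ 2)
        where
        by-residue : Dec (q % 3 ≡ 2) → Forms u
        by-residue (yes q%3≡2) = inj₂ (inj₁ (q%3≡2 , form2 q%3≡2))
        by-residue (no  q%3≢2) = inj₂ (inj₂ (q%3≡0 q%3≢2 , form3 q%3≢2))

    onSurface⇒forms : Forms u
    onSurface⇒forms = by-zero (any? (λ i → u i ≟ 0#))
      where
      by-second-zero : ∀ {i} → u i ≈ 0# → Dec (∃[ m ] u (punchIn i m) ≈ 0#) → Forms u
      by-second-zero {i} uᵢ≈0 (yes (m , uⱼ≈0)) =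
        inj₁ (form1 (pairUp i m) (trans (+-cong (ν-≈0 uᵢ≈0) (ν-≈0 uⱼ≈0)) (+-identityˡ 0#)))
      by-second-zero {i} uᵢ≈0 (no ∄uⱼ≈0) = OneZero.forms i uᵢ≈0 (λ m uⱼ≈0 → ∄uⱼ≈0 (m , uⱼ≈0))
      by-zero : Dec (∃[ i ] u i ≈ 0#) → Forms u
      by-zero (no  ∄uᵢ≈0)     = inj₁ (no-zero (λ i uᵢ≈0 → ∄uᵢ≈0 (i , uᵢ≈0)))
      by-zero (yes (i , uᵢ≈0)) = by-second-zero uᵢ≈0 (any? (λ m → u (punchIn i m) ≟ 0#))

  form1⇒sum : ∀ v → Form1 q v → sum (ν ∘ v) ≈ 0#
  form1⇒sum v (_ , σ , first , second) = begin
    sum (ν ∘ v)                   ≈⟨ sum-permute₄ (ν ∘ v) σ ⟩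
    a 0F + (a 1F + (a 2F + a 3F))  ≈⟨ +-assoc _ _ _ ⟨
    (a 0F + a 1F) + (a 2F + a 3F)  ≈⟨ +-cong (x≈-y⇒x+y≈0 first) (x≈-y⇒x+y≈0 second) ⟩
    0# + 0#                        ≈⟨ +-identityˡ 0# ⟩
    0#                             ∎
    where
    a : Fin 4 → Carrier
    a = ν ∘ v ∘ (σ ⟨$⟩ʳ_)
    x≈-y⇒x+y≈0 : ∀ {x y} → x ≈ - y → x + y ≈ 0#
    x≈-y⇒x+y≈0 x≈-y = trans (+-congʳ x≈-y) (-‿inverseˡ _)

  form2⇒sum : ∀ v → Form2 q v → sum (ν ∘ v) ≈ 0#
  form2⇒sum v (i , j , k , l , (vᵢ≈0 , _) , i≢j , i≢k , i≢l , j≢k , j≢l , k≢l , j³≈1 , k³≈1 , l³≈1 , j≉k , j≉l , k≉l) = begin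
    sum (ν ∘ v)                                         ≈⟨ sum-reindex (ν ∘ v) (distinct⇒injective i≢j i≢k i≢l j≢k j≢l k≢l) ⟨
    ν (v i) + (ν (v j) + (ν (v k) + (ν (v l) + 0#)))    ≈⟨ +-cong (ν-≈0 vᵢ≈0) (+-congˡ (+-congˡ (+-identityʳ _))) ⟩
    0# + (ν (v j) + (ν (v k) + ν (v l)))                ≈⟨ +-identityˡ _ ⟩
    ν (v j) + (ν (v k) + ν (v l))                       ≈⟨ cube-roots-sum≈0 j³≈1 k³≈1 l³≈1 j≉k j≉l k≉l ⟩
    0#                                                  ∎

  form3⇒sum : q % 3 ≡ 0 → ∀ v → Form3 q v → sum (ν ∘ v) ≈ 0#
  form3⇒sum q%3≡0 v (v∈𝔽q , i , vᵢ≈0 , others≉0) = begin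
    sum (ν ∘ v)                                             ≈⟨ sum-permute₄ (ν ∘ v) (isolate i) ⟩
    ν (v i) + (a 0F + (a 1F + a 2F))                        ≈⟨ +-cong (ν-≈0 vᵢ≈0) (+-cong (a≈1 0F) (+-cong (a≈1 1F) (a≈1 2F))) ⟩
    0# + (1# + (1# + 1#))                                   ≈⟨ +-identityˡ _ ⟩
    1# + (1# + 1#)                                          ≈⟨ +-congˡ (+-congˡ (+-identityʳ 1#)) ⟨
    3 ×ₙ 1#                                                 ≈⟨ 3≈0 q%3≡0 ⟩
    0#                                                      ∎
    where
    a : Fin 3 → Carrier
    a m = ν (v (punchIn i m))
    a≈1 : ∀ m → a m ≈ 1#
    a≈1 m = subfield⇒ν≈1 (others≉0 _ (punchInᵢ≢i i m)) (v∈𝔽q _)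

  pointOfForm⇒sum : ∀ {P : Coords → Set ℓ} → (∀ v → P v → sum (ν ∘ v) ≈ 0#) →
                    ∀ u → PointOfForm P u → sum (ν ∘ u) ≈ 0#
  pointOfForm⇒sum P⇒sum≈0 u (w , w≉0 , Pwu) =
    x*y≈0⇒y≈0 (ν-≉0 w≉0) (trans (sym (sum-ν-scale w u)) (P⇒sum≈0 (scale w u) Pwu))

  forms⇒sum : ∀ u → Forms u → sum (ν ∘ u) ≈ 0#
  forms⇒sum u (inj₁ point)                  = pointOfForm⇒sum form1⇒sum u point
  forms⇒sum u (inj₂ (inj₁ (_ , point)))     = pointOfForm⇒sum form2⇒sum u point
  forms⇒sum u (inj₂ (inj₂ (q%3≡0 , point))) = pointOfForm⇒sum (form3⇒sum q%3≡0) u point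

theorem5 : {c ℓ : Level} (p r q : ℕ) → Prime p → r ≥ 1 → q ≡ p ^ r →
    (F : CommutativeRing c ℓ) → IsField F → HasCardinality F (q ^ 2) →
    let open FieldNotions F in
    (u : Coords) → NonZeroTuple u →
    (OnSurface q u ⇔
      (PointOfForm (Form1 q) u
      ⊎ ((q % 3 ≡ 2) × PointOfForm (Form2 q) u)
      ⊎ ((q % 3 ≡ 0) × PointOfForm (Form3 q) u)))
theorem5 p r .(p ^ r) p-prime r≥1 ≡.refl F isField card u u≢0 =
  mk⇔ (onSurface⇒forms u≢0 ∘ Equivalence.to (onSurface⇔sum u))
      (Equivalence.from (onSurface⇔sum u) ∘ forms⇒sum u)
  where
  open FermatSurface F isField p-prime r≥1 card
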